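{- Let $\mathcal{C}$ and $\mathcal{D}$ be gs-monoidal categories and $F:\mathcal{C}\to\mathcal{D}$ a lax symmetric monoidal functor. Then: (i) if $F$ is domain preserving then it is mass preserving; (ii) if $F$ is mass preserving then it is unital domain preserving.
   Context: Composition is diagrammatic ($f;g$ means first $f$, then $g$); the right unitor is $\rho_X:X\to X\otimes I$. A gs-monoidal category is a symmetric monoidal category with, for each object $X$, a discharger $!_X:X\to I$ and duplicator $\nabla_X:X\to X\otimes X$, compatible with the monoidal structure, with $\nabla_X$ coassociative, cocommutative, and $(X,\nabla_X,!_X)$ a comonoid. $F$ lax symmetric monoidal has structure arrows $\psi_{X,Y}:F(X)\otimes F(Y)\to F(X\otimes Y)$, $\psi_0:I\to F(I)$. $F$ is domain preserving if for all objects $X$: $\nabla_{F(X)};\psi_{X,X};F(\mathrm{id}_X\otimes !_X)=F(\rho_X)$. $F$ is unital domain preserving if this equation holds for $X=I$. $F$ is mass preserving if for all $X$: $\nabla_{F(X)};\psi_{X,X};F(!_X\otimes !_X)=F(!_X);F(\rho_I)$. -}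

module Defs where

open import Level using (Level; _⊔_; suc)
open import Relation.Binary using (Rel; IsEquivalence)

-- Composition is diagrammatic throughout:  f ⨾ g  means first f, then g.

record SymmetricMonoidalCategory (o ℓ e : Level) : Set (suc (o ⊔ ℓ ⊔ e)) where
  infixr 9 _⨾_
  infixr 10 _⊗₀_ _⊗₁_
  infix  4 _≈_
  field
    Obj   : Set o
    _⇒_   : Obj → Obj → Set ℓ
    _≈_   : ∀ {A B} → Rel (A ⇒ B) e
    ≈-equiv : ∀ {A B} → IsEquivalence (_≈_ {A} {B})
    id    : ∀ {A} → A ⇒ A
    _⨾_   : ∀ {A B C} → A ⇒ B → B ⇒ C → A ⇒ C
    ⨾-assoc : ∀ {A B C D} {f : A ⇒ B} {g : B ⇒ C} {h : C ⇒ D} →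
              (f ⨾ g) ⨾ h ≈ f ⨾ (g ⨾ h)
    ⨾-idˡ   : ∀ {A B} {f : A ⇒ B} → id ⨾ f ≈ f
    ⨾-idʳ   : ∀ {A B} {f : A ⇒ B} → f ⨾ id ≈ f
    ⨾-resp-≈ : ∀ {A B C} {f f′ : A ⇒ B} {g g′ : B ⇒ C} →
               f ≈ f′ → g ≈ g′ → f ⨾ g ≈ f′ ⨾ g′
    _⊗₀_  : Obj → Obj → Obj
    _⊗₁_  : ∀ {A B C D} → A ⇒ B → C ⇒ D → (A ⊗₀ C) ⇒ (B ⊗₀ D)
    ⊗-id  : ∀ {A C} → id {A} ⊗₁ id {C} ≈ id
    ⊗-⨾ : ∀ {A B C D E F} {f : A ⇒ B} {g : B ⇒ C} {h : D ⇒ E} {k : E ⇒ F} →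
               (f ⨾ g) ⊗₁ (h ⨾ k) ≈ (f ⊗₁ h) ⨾ (g ⊗₁ k)
    ⊗-resp-≈ : ∀ {A B C D} {f f′ : A ⇒ B} {g g′ : C ⇒ D} →
               f ≈ f′ → g ≈ g′ → f ⊗₁ g ≈ f′ ⊗₁ g′
    I     : Obj
    α     : ∀ {X Y Z} → ((X ⊗₀ Y) ⊗₀ Z) ⇒ (X ⊗₀ (Y ⊗₀ Z))
    α⁻¹   : ∀ {X Y Z} → (X ⊗₀ (Y ⊗₀ Z)) ⇒ ((X ⊗₀ Y) ⊗₀ Z)
    α-iso₁ : ∀ {X Y Z} → α {X} {Y} {Z} ⨾ α⁻¹ ≈ id
    α-iso₂ : ∀ {X Y Z} → α⁻¹ {X} {Y} {Z} ⨾ α ≈ id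
    α-nat  : ∀ {A B C D E F} {f : A ⇒ B} {g : C ⇒ D} {h : E ⇒ F} →
             ((f ⊗₁ g) ⊗₁ h) ⨾ α ≈ α ⨾ (f ⊗₁ (g ⊗₁ h))
    λ′    : ∀ {X} → X ⇒ (I ⊗₀ X)
    λ⁻¹   : ∀ {X} → (I ⊗₀ X) ⇒ X
    λ-iso₁ : ∀ {X} → λ′ {X} ⨾ λ⁻¹ ≈ id
    λ-iso₂ : ∀ {X} → λ⁻¹ {X} ⨾ λ′ ≈ id
    λ-nat  : ∀ {A B} {f : A ⇒ B} → f ⨾ λ′ ≈ λ′ ⨾ (id ⊗₁ f)
    ρ     : ∀ {X} → X ⇒ (X ⊗₀ I)
    ρ⁻¹   : ∀ {X} → (X ⊗₀ I) ⇒ X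
    ρ-iso₁ : ∀ {X} → ρ {X} ⨾ ρ⁻¹ ≈ id
    ρ-iso₂ : ∀ {X} → ρ⁻¹ {X} ⨾ ρ ≈ id
    ρ-nat  : ∀ {A B} {f : A ⇒ B} → f ⨾ ρ ≈ ρ ⨾ (f ⊗₁ id)
    triangle : ∀ {X Y} → ρ⁻¹ {X} ⊗₁ id {Y} ≈ α ⨾ (id ⊗₁ λ⁻¹)
    pentagon : ∀ {A B C D} →
               α {A ⊗₀ B} {C} {D} ⨾ α {A} {B} {C ⊗₀ D}
                 ≈ (α ⊗₁ id) ⨾ (α ⨾ (id ⊗₁ α))
    σ      : ∀ {X Y} → (X ⊗₀ Y) ⇒ (Y ⊗₀ X)
    σ-nat  : ∀ {A B C D} {f : A ⇒ B} {g : C ⇒ D} → (f ⊗₁ g) ⨾ σ ≈ σ ⨾ (g ⊗₁ f)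
    σ-inv  : ∀ {X Y} → σ {X} {Y} ⨾ σ ≈ id
    hexagon : ∀ {X Y Z} →
              α {X} {Y} {Z} ⨾ (σ {X} {Y ⊗₀ Z} ⨾ α)
                ≈ (σ ⊗₁ id) ⨾ (α ⨾ (id ⊗₁ σ))

  interchange : ∀ {X X′ Y Y′} → ((X ⊗₀ X′) ⊗₀ (Y ⊗₀ Y′)) ⇒ ((X ⊗₀ Y) ⊗₀ (X′ ⊗₀ Y′))
  interchange = α ⨾ ((id ⊗₁ α⁻¹) ⨾ ((id ⊗₁ (σ ⊗₁ id)) ⨾ ((id ⊗₁ α) ⨾ α⁻¹)))

record GSMonoidalCategory (o ℓ e : Level) : Set (suc (o ⊔ ℓ ⊔ e)) where
  field
    smc : SymmetricMonoidalCategory o ℓ e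
  open SymmetricMonoidalCategory smc
  field
    ! : ∀ X → X ⇒ I
    ∇ : ∀ X → X ⇒ (X ⊗₀ X)
    ∇-coassoc : ∀ {X} → ∇ X ⨾ ((∇ X ⊗₁ id) ⨾ α) ≈ ∇ X ⨾ (id ⊗₁ ∇ X)
    ∇-cocomm  : ∀ {X} → ∇ X ⨾ σ ≈ ∇ X
    counitʳ   : ∀ {X} → ∇ X ⨾ (id ⊗₁ ! X) ≈ ρ
    counitˡ   : ∀ {X} → ∇ X ⨾ (! X ⊗₁ id) ≈ λ′
    !-I   : ! I ≈ id
    !-⊗   : ∀ {X Y} → ! (X ⊗₀ Y) ≈ (! X ⊗₁ ! Y) ⨾ λ⁻¹
    ∇-I   : ∇ I ≈ λ′
    ∇-⊗   : ∀ {X Y} → ∇ (X ⊗₀ Y) ≈ (∇ X ⊗₁ ∇ Y) ⨾ interchange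

  open SymmetricMonoidalCategory smc public

module _ {o ℓ e o′ ℓ′ e′ : Level}
         (C : SymmetricMonoidalCategory o ℓ e)
         (D : SymmetricMonoidalCategory o′ ℓ′ e′) where
  private
    module C = SymmetricMonoidalCategory C
    module D = SymmetricMonoidalCategory D
  open D using (_⨾_; _≈_; _⊗₀_; _⊗₁_)

  record LaxSymmetricMonoidalFunctor : Set (o ⊔ ℓ ⊔ e ⊔ o′ ⊔ ℓ′ ⊔ e′) where
    field
      F₀ : C.Obj → D.Obj
      F₁ : ∀ {A B} → A C.⇒ B → F₀ A D.⇒ F₀ B
      F-id : ∀ {A} → F₁ (C.id {A}) ≈ D.id
      F-⨾  : ∀ {A B C′} {f : A C.⇒ B} {g : B C.⇒ C′} → F₁ (f C.⨾ g) ≈ F₁ f ⨾ F₁ g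
      F-resp-≈ : ∀ {A B} {f g : A C.⇒ B} → f C.≈ g → F₁ f ≈ F₁ g
      ψ  : ∀ {X Y} → (F₀ X ⊗₀ F₀ Y) D.⇒ F₀ (X C.⊗₀ Y)
      ψ₀ : D.I D.⇒ F₀ C.I
      ψ-nat : ∀ {A B A′ B′} {f : A C.⇒ B} {g : A′ C.⇒ B′} →
              (F₁ f ⊗₁ F₁ g) ⨾ ψ ≈ ψ ⨾ F₁ (f C.⊗₁ g)
      ψ-assoc : ∀ {X Y Z} →
                (ψ {X} {Y} ⊗₁ D.id) ⨾ (ψ ⨾ F₁ (C.α {X} {Y} {Z}))
                  ≈ D.α ⨾ ((D.id ⊗₁ ψ) ⨾ ψ)
      ψ-unitˡ : ∀ {X} → D.λ′ ⨾ ((ψ₀ ⊗₁ D.id) ⨾ ψ) ≈ F₁ (C.λ′ {X})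
      ψ-unitʳ : ∀ {X} → D.ρ ⨾ ((D.id ⊗₁ ψ₀) ⨾ ψ) ≈ F₁ (C.ρ {X})
      ψ-sym   : ∀ {X Y} → D.σ ⨾ ψ {Y} {X} ≈ ψ ⨾ F₁ C.σ

module _ {o ℓ e o′ ℓ′ e′ : Level}
         (C : GSMonoidalCategory o ℓ e)
         (D : GSMonoidalCategory o′ ℓ′ e′) where
  private
    module C = GSMonoidalCategory C
    module D = GSMonoidalCategory D
  open D using (_⨾_; _≈_)

  module _ (F : LaxSymmetricMonoidalFunctor C.smc D.smc) where
    open LaxSymmetricMonoidalFunctor F

    DomainPreservingAt : C.Obj → Set e′
    DomainPreservingAt X =
      D.∇ (F₀ X) ⨾ (ψ {X} {X} ⨾ F₁ (C.id C.⊗₁ C.! X)) ≈ F₁ (C.ρ {X})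

    DomainPreserving : Set (o ⊔ e′)
    DomainPreserving = ∀ X → DomainPreservingAt X

    UnitalDomainPreserving : Set e′
    UnitalDomainPreserving = DomainPreservingAt C.I

    MassPreserving : Set (o ⊔ e′)
    MassPreserving = ∀ X →
      D.∇ (F₀ X) ⨾ (ψ {X} {X} ⨾ F₁ (C.! X C.⊗₁ C.! X)) ≈ F₁ (C.! X) ⨾ F₁ (C.ρ {C.I})

{-# OPTIONS --safe #-}
module Submission where

open import Defs
open import Data.Product using (_×_; _,_)
open import Relation.Binary using (Setoid; IsEquivalence)
import Relation.Binary.Reasoning.Setoid as SetoidReasoning

-- Discharging both copies of a duplicated F X factors through discharging the
-- second copy, which domain preservation turns into F ρ; naturality of ρ then
-- moves the remaining discharger in front. Conversely, at the unit !_I is the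
-- identity, so the mass and domain equations at I coincide.

module SymmetricMonoidalProperties {o ℓ e} (C : SymmetricMonoidalCategory o ℓ e) where
  open SymmetricMonoidalCategory C
  private
    module ≈ {A B} = IsEquivalence (≈-equiv {A} {B})

  homSetoid : Obj → Obj → Setoid ℓ e
  homSetoid A B = record { Carrier = A ⇒ B ; _≈_ = _≈_ ; isEquivalence = ≈-equiv }

  ⨾-congˡ : ∀ {A B C′} {f : A ⇒ B} {g g′ : B ⇒ C′} → g ≈ g′ → f ⨾ g ≈ f ⨾ g′
  ⨾-congˡ = ⨾-resp-≈ ≈.refl

  ⨾-congʳ : ∀ {A B C′} {f f′ : A ⇒ B} {g : B ⇒ C′} → f ≈ f′ → f ⨾ g ≈ f′ ⨾ g
  ⨾-congʳ f≈f′ = ⨾-resp-≈ f≈f′ ≈.refl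

  serialize₂₁ : ∀ {A B C′ D′} {f : A ⇒ B} {g : C′ ⇒ D′} → f ⊗₁ g ≈ (id ⊗₁ g) ⨾ (f ⊗₁ id)
  serialize₂₁ = ≈.trans (⊗-resp-≈ (≈.sym ⨾-idˡ) (≈.sym ⨾-idʳ)) ⊗-⨾

module LaxFunctorProperties {o ℓ e o′ ℓ′ e′}
    {C : SymmetricMonoidalCategory o ℓ e} {D : SymmetricMonoidalCategory o′ ℓ′ e′}
    (F : LaxSymmetricMonoidalFunctor C D) where
  private
    module C = SymmetricMonoidalCategory C
    module D = SymmetricMonoidalCategory D
    module ≈ {A B} = IsEquivalence (D.≈-equiv {A} {B})
    module C≈ {A B} = IsEquivalence (C.≈-equiv {A} {B})
  open LaxSymmetricMonoidalFunctor F
  open D using (_⨾_; _≈_)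
  open SymmetricMonoidalProperties D using (homSetoid)

  F-ρ-nat : ∀ {A B} {f : A C.⇒ B} → F₁ C.ρ ⨾ F₁ (f C.⊗₁ C.id) ≈ F₁ f ⨾ F₁ C.ρ
  F-ρ-nat {f = f} = begin
    F₁ C.ρ ⨾ F₁ (f C.⊗₁ C.id)  ≈⟨ ≈.sym F-⨾ ⟩
    F₁ (C.ρ C.⨾ (f C.⊗₁ C.id)) ≈⟨ F-resp-≈ (C≈.sym C.ρ-nat) ⟩
    F₁ (f C.⨾ C.ρ)             ≈⟨ F-⨾ ⟩
    F₁ f ⨾ F₁ C.ρ              ∎
    where open SetoidReasoning (homSetoid _ _)

module _ {o ℓ e o′ ℓ′ e′} (C : GSMonoidalCategory o ℓ e) (D : GSMonoidalCategory o′ ℓ′ e′)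
    (F : LaxSymmetricMonoidalFunctor (GSMonoidalCategory.smc C) (GSMonoidalCategory.smc D)) where
  private
    module C = GSMonoidalCategory C
    module D = GSMonoidalCategory D
    module ≈ {A B} = IsEquivalence (D.≈-equiv {A} {B})
    module C≈ {A B} = IsEquivalence (C.≈-equiv {A} {B})
  open LaxSymmetricMonoidalFunctor F
  open D using (_⨾_; _≈_)
  open SymmetricMonoidalProperties D.smc using (homSetoid; ⨾-congˡ; ⨾-congʳ)
  open SymmetricMonoidalProperties C.smc using (serialize₂₁)
  open LaxFunctorProperties F using (F-ρ-nat)

  MassPreservingAt : C.Obj → Set e′
  MassPreservingAt X =
    D.∇ (F₀ X) ⨾ (ψ {X} {X} ⨾ F₁ (C.! X C.⊗₁ C.! X)) ≈ F₁ (C.! X) ⨾ F₁ (C.ρ {C.I})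

  mass≈domain⨾F[!⊗id] : ∀ X →
    D.∇ (F₀ X) ⨾ (ψ ⨾ F₁ (C.! X C.⊗₁ C.! X))
      ≈ (D.∇ (F₀ X) ⨾ (ψ ⨾ F₁ (C.id C.⊗₁ C.! X))) ⨾ F₁ (C.! X C.⊗₁ C.id)
  mass≈domain⨾F[!⊗id] X = begin
    D.∇ (F₀ X) ⨾ (ψ ⨾ F₁ (C.! X C.⊗₁ C.! X))
      ≈⟨ ⨾-congˡ (⨾-congˡ (≈.trans (F-resp-≈ serialize₂₁) F-⨾)) ⟩
    D.∇ (F₀ X) ⨾ (ψ ⨾ (F₁ (C.id C.⊗₁ C.! X) ⨾ F₁ (C.! X C.⊗₁ C.id)))
      ≈⟨ ⨾-congˡ (≈.sym D.⨾-assoc) ⟩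
    D.∇ (F₀ X) ⨾ ((ψ ⨾ F₁ (C.id C.⊗₁ C.! X)) ⨾ F₁ (C.! X C.⊗₁ C.id))
      ≈⟨ ≈.sym D.⨾-assoc ⟩
    (D.∇ (F₀ X) ⨾ (ψ ⨾ F₁ (C.id C.⊗₁ C.! X))) ⨾ F₁ (C.! X C.⊗₁ C.id)
      ∎
    where open SetoidReasoning (homSetoid _ _)

  domainPreservingAt⇒massPreservingAt : ∀ X → DomainPreservingAt C D F X → MassPreservingAt X
  domainPreservingAt⇒massPreservingAt X dp = begin
    D.∇ (F₀ X) ⨾ (ψ ⨾ F₁ (C.! X C.⊗₁ C.! X))                          ≈⟨ mass≈domain⨾F[!⊗id] X ⟩
    (D.∇ (F₀ X) ⨾ (ψ ⨾ F₁ (C.id C.⊗₁ C.! X))) ⨾ F₁ (C.! X C.⊗₁ C.id) ≈⟨ ⨾-congʳ dp ⟩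
    F₁ C.ρ ⨾ F₁ (C.! X C.⊗₁ C.id)                                     ≈⟨ F-ρ-nat ⟩
    F₁ (C.! X) ⨾ F₁ C.ρ                                               ∎
    where open SetoidReasoning (homSetoid _ _)

  massPreservingAt-I⇒domainPreservingAt-I : MassPreservingAt C.I → DomainPreservingAt C D F C.I
  massPreservingAt-I⇒domainPreservingAt-I mp = begin
    D.∇ (F₀ C.I) ⨾ (ψ ⨾ F₁ (C.id C.⊗₁ C.! C.I))
      ≈⟨ ⨾-congˡ (⨾-congˡ (F-resp-≈ (C.⊗-resp-≈ (C≈.sym C.!-I) C≈.refl))) ⟩
    D.∇ (F₀ C.I) ⨾ (ψ ⨾ F₁ (C.! C.I C.⊗₁ C.! C.I)) ≈⟨ mp ⟩
    F₁ (C.! C.I) ⨾ F₁ C.ρ                          ≈⟨ ⨾-congʳ (≈.trans (F-resp-≈ C.!-I) F-id) ⟩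
    D.id ⨾ F₁ C.ρ                                  ≈⟨ D.⨾-idˡ ⟩
    F₁ C.ρ                                         ∎
    where open SetoidReasoning (homSetoid _ _)

lemma4p3 : ∀ {o ℓ e o′ ℓ′ e′} (C : GSMonoidalCategory o ℓ e) (D : GSMonoidalCategory o′ ℓ′ e′)
    (F : LaxSymmetricMonoidalFunctor (GSMonoidalCategory.smc C) (GSMonoidalCategory.smc D)) →
    (DomainPreserving C D F → MassPreserving C D F) × (MassPreserving C D F → UnitalDomainPreserving C D F)
lemma4p3 C D F =
    (λ dp X → domainPreservingAt⇒massPreservingAt C D F X (dp X))
  , (λ mp → massPreservingAt-I⇒domainPreservingAt-I C D F (mp (GSMonoidalCategory.I C)))
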